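{- Let $x,y,n$ be integers such that $1\leq x<y<n$. There is no perfect matching $F$ of $K_{2n}$ such that $\ell(F)=\{x,y,n^{n-2}\}$ (i.e. one edge of length $x$, one edge of length $y$, and $n-2$ edges of length $n$).
   Context: For a positive integer $v$, $K_v$ denotes the complete graph on the vertex set $\{0,1,\ldots,v-1\}$. The length of an edge $\{u,w\}$ of $K_v$ is $\ell(u,w)=\min(|u-w|,\,v-|u-w|)$. For a subgraph $\Gamma$ of $K_v$, $\ell(\Gamma)$ is the list (multiset) of lengths of all edges of $\Gamma$, counted with multiplicity. A perfect matching of $K_{2n}$ is a set of $n$ pairwise disjoint edges covering all vertices. -}

module Defs where

open import Data.Nat using (ℕ; _⊔_; _⊓_; _∸_; ∣_-_∣)
open import Data.Fin using (Fin; toℕ)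
open import Data.Product using (Σ; _×_; _,_; proj₁; proj₂)
open import Data.List using (List; []; _∷_; map; concatMap; allFin)
open import Data.List.Relation.Binary.Permutation.Propositional using (_↭_)
open import Relation.Binary.PropositionalEquality using (_≢_)

-- An edge of K_v: an unordered pair of distinct vertices, represented by an
-- ordered pair (u , w) with u ≢ w.
Edge : ℕ → Set
Edge v = Σ (Fin v × Fin v) λ p → proj₁ p ≢ proj₂ p

edgeLength : ∀ {v} → Edge v → ℕ
edgeLength {v} ((u , w) , _) = ∣ toℕ u - toℕ w ∣ ⊓ (v ∸ ∣ toℕ u - toℕ w ∣)

-- ℓ(Γ): list of lengths of the edges (multiset, compared up to permutation)
lengths : ∀ {v} → List (Edge v) → List ℕ
lengths = map edgeLength

endpoints : ∀ {v} → List (Edge v) → List (Fin v)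
endpoints = concatMap (λ e → proj₁ (proj₁ e) ∷ proj₂ (proj₁ e) ∷ [])

-- A perfect matching of K_v: a set of pairwise disjoint edges covering all
-- vertices, i.e. every vertex is an endpoint of exactly one edge:
-- the list of all endpoints is a permutation of the vertex list.
IsPerfectMatching : ∀ {v} → List (Edge v) → Set
IsPerfectMatching {v} F = endpoints F ↭ allFin v

-- The edges of length n are exactly the diameters of K_2n, which join each
-- vertex a to its antipode a + n (mod 2n).  The n - 2 diameters of F therefore
-- cover a set of vertices closed under the antipodal map, and so do the four
-- remaining endpoints a, b, c, d.  Since ab is not a diameter, the antipodes of a
-- and b are c and d in some order, and the rotation by n, being an isometry,
-- gives cd the same length as ab: x = y.
module Submission where

open import Defs
open import Data.Nat using (ℕ; _≤_; _<_; _*_; _∸_)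
open import Data.List using (List; _∷_; replicate)
open import Data.List.Relation.Binary.Permutation.Propositional using (_↭_)
open import Data.Product using (_×_)
open import Relation.Nullary using (¬_)

open import Data.Empty using (⊥-elim)
open import Data.Fin using (Fin; toℕ; fromℕ<)
open import Data.Fin.Properties using (toℕ-injective; toℕ<n; toℕ-fromℕ<)
open import Data.List using (concatMap)
open import Data.List.Membership.Propositional using (_∈_; _∉_)
open import Data.List.Membership.Propositional.Properties using (∈-allFin)
open import Data.List.Properties using (∷-injective)
open import Data.List.Relation.Binary.Permutation.Propositional
  using (refl; prep; swap; trans; ↭-sym; ↭-trans; ↭⇒↭ₛ)
open import Data.List.Relation.Binary.Permutation.Propositional.Properties
  using (∈-resp-↭; ++⁺ˡ; shifts; ↭-map-inv)
import Data.List.Relation.Binary.Permutation.Setoid.Properties as Permutationₛ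
open import Data.List.Relation.Unary.All using (All; _∷_)
import Data.List.Relation.Unary.AllPairs as AllPairs
open import Data.List.Relation.Unary.All.Properties using (map⁻; replicate⁺)
open import Data.List.Relation.Unary.Any using (here; there)
open import Data.List.Relation.Unary.Unique.Propositional using (Unique)
open import Data.List.Relation.Unary.Unique.Propositional.Properties
  using (allFin⁺; Unique[x∷xs]⇒x∉xs)
open import Data.Nat using (_+_; _⊓_; ∣_-_∣; _<?_)
open import Data.Nat.Properties
open import Data.Nat.Tactic.RingSolver using (solve-∀)
open import Data.Product using (∃-syntax; _,_; proj₁; proj₂)
open import Data.Sum using (_⊎_; inj₁; inj₂)
open import Function using (_∘_)
open import Relation.Binary.PropositionalEquality
  using (_≡_; _≢_; refl; sym; cong; cong₂; subst; subst₂; setoid; module ≡-Reasoning)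
  renaming (trans to ≡-trans)
open import Relation.Nullary using (yes; no)

private variable
  A : Set

Unique-resp-↭ : {xs ys : List A} → xs ↭ ys → Unique xs → Unique ys
Unique-resp-↭ p = Permutationₛ.Unique-resp-↭ (setoid _) (↭⇒↭ₛ p)

concatMap⁺ : {B : Set} (f : A → List B) {xs ys : List A} →
             xs ↭ ys → concatMap f xs ↭ concatMap f ys
concatMap⁺ f refl         = refl
concatMap⁺ f (prep x p)   = ++⁺ˡ (f x) (concatMap⁺ f p)
concatMap⁺ f (swap x y p) = ↭-trans (shifts (f x) (f y)) (++⁺ˡ (f y) (++⁺ˡ (f x) (concatMap⁺ f p)))
concatMap⁺ f (trans p q)  = ↭-trans (concatMap⁺ f p) (concatMap⁺ f q)

∈-resolve : {a b c d z : A} {xs : List A} → z ∈ a ∷ b ∷ c ∷ d ∷ xs →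
            z ∉ xs → z ≢ a → z ≢ b → z ≡ c ⊎ z ≡ d
∈-resolve (here z≡a)                         _   z≢a _   = ⊥-elim (z≢a z≡a)
∈-resolve (there (here z≡b))                 _   _   z≢b = ⊥-elim (z≢b z≡b)
∈-resolve (there (there (here z≡c)))         _   _   _   = inj₁ z≡c
∈-resolve (there (there (there (here z≡d)))) _   _   _   = inj₂ z≡d
∈-resolve (there (there (there (there z∈)))) z∉ _   _   = ⊥-elim (z∉ z∈)

2*n≡n+n : ∀ n → 2 * n ≡ n + n
2*n≡n+n n = cong (n +_) (+-identityʳ n)

-- edgeLength ((u , w) , _) is definitionally cyclicLength v ∣ toℕ u - toℕ w ∣.
cyclicLength : ℕ → ℕ → ℕ
cyclicLength v d = d ⊓ (v ∸ d)

cyclicLength-complement : ∀ {v d d′} → d + d′ ≡ v → cyclicLength v d ≡ cyclicLength v d′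
cyclicLength-complement {d = d} {d′} refl
  rewrite m+n∸m≡n d d′ | m+n∸n≡m d d′ = ⊓-comm d d′

cyclicLength[2n]-n : ∀ n → cyclicLength (2 * n) n ≡ n
cyclicLength[2n]-n n rewrite 2*n≡n+n n | m+n∸m≡n n n = ⊓-idem n

cyclicLength[2n]≡n⇒≡n : ∀ {n d} → d ≤ 2 * n → cyclicLength (2 * n) d ≡ n → d ≡ n
cyclicLength[2n]≡n⇒≡n {n} {d} d≤2n eq = ≤-antisym (+-cancelˡ-≤ n d n n+d≤n+n) n≤d
  where
  n≤d : n ≤ d
  n≤d = subst (_≤ d) eq (m⊓n≤m d (2 * n ∸ d))
  n+d≤n+n : n + d ≤ n + n
  n+d≤n+n = subst (n + d ≤_) (≡-trans (m∸n+n≡m d≤2n) (2*n≡n+n n))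
                  (+-monoˡ-≤ d (subst (_≤ 2 * n ∸ d) eq (m⊓n≤n d (2 * n ∸ d))))

k+n+n≮2n : ∀ {k n} → ¬ (k + n + n < 2 * n)
k+n+n≮2n {k} {n} lt = <⇒≱ lt (subst₂ _≤_ (sym (2*n≡n+n n)) (sym (+-assoc k n n)) (m≤n+m (n + n) k))

m+n<2n⇒m≤n : ∀ {m n} → m + n < 2 * n → m ≤ n
m+n<2n⇒m≤n {m} {n} lt = +-cancelʳ-≤ n m n (subst (m + n ≤_) (2*n≡n+n n) (<⇒≤ lt))

∣m+n-o∣+∣m-o+n∣≡2n : ∀ {n m o} → m ≤ n → o ≤ n → ∣ m + n - o ∣ + ∣ m - o + n ∣ ≡ 2 * n
∣m+n-o∣+∣m-o+n∣≡2n {n} {m} {o} m≤n o≤n = begin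
  ∣ m + n - o ∣ + ∣ m - o + n ∣      ≡⟨ cong₂ _+_ (m≤n⇒∣n-m∣≡n∸m (≤-trans o≤n (m≤n+m n m)))
                                                  (m≤n⇒∣m-n∣≡n∸m (≤-trans m≤n (m≤n+m n o))) ⟩
  (m + n ∸ o) + (o + n ∸ m)          ≡⟨ cong₂ _+_ (+-∸-assoc m o≤n) (+-∸-assoc o m≤n) ⟩
  (m + (n ∸ o)) + (o + (n ∸ m))      ≡⟨ regroup m o (n ∸ o) (n ∸ m) ⟩
  (m + (n ∸ m)) + (o + (n ∸ o))      ≡⟨ cong₂ _+_ (m+[n∸m]≡n m≤n) (m+[n∸m]≡n o≤n) ⟩
  n + n                              ≡⟨ sym (2*n≡n+n n) ⟩
  2 * n                              ∎
  where
  open ≡-Reasoning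
  regroup : ∀ m o p q → (m + p) + (o + q) ≡ (m + q) + (o + p)
  regroup = solve-∀

∣m+n-o+n∣≡∣m-o∣ : ∀ n m o → ∣ m + n - o + n ∣ ≡ ∣ m - o ∣
∣m+n-o+n∣≡∣m-o∣ n m o rewrite +-comm m n | +-comm o n = ∣m+n-m+o∣≡∣n-o∣ n m o

Antipodal : ℕ → ℕ → ℕ → Set
Antipodal n i j = j ≡ i + n ⊎ i ≡ j + n

module _ {n : ℕ} where

  Antipodal-sym : ∀ {i j} → Antipodal n i j → Antipodal n j i
  Antipodal-sym (inj₁ p) = inj₂ p
  Antipodal-sym (inj₂ p) = inj₁ p

  Antipodal⇒∣-∣≡n : ∀ {i j} → Antipodal n i j → ∣ i - j ∣ ≡ n
  Antipodal⇒∣-∣≡n {i}     (inj₁ refl) = ∣m-m+n∣≡n i n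
  Antipodal⇒∣-∣≡n {j = j} (inj₂ refl) = ≡-trans (∣-∣-comm (j + n) j) (∣m-m+n∣≡n j n)

  ∣-∣≡n⇒Antipodal : ∀ {i j} → ∣ i - j ∣ ≡ n → Antipodal n i j
  ∣-∣≡n⇒Antipodal {i} {j} refl with ≤-total i j
  ... | inj₁ i≤j = inj₁ (sym (≡-trans (cong (i +_) (m≤n⇒∣m-n∣≡n∸m i≤j)) (m+[n∸m]≡n i≤j)))
  ... | inj₂ j≤i = inj₂ (sym (≡-trans (cong (j +_) (m≤n⇒∣n-m∣≡n∸m j≤i)) (m+[n∸m]≡n j≤i)))

  Antipodal-refl⇒n≡0 : ∀ {i} → Antipodal n i i → n ≡ 0
  Antipodal-refl⇒n≡0 {i} p = ≡-trans (sym (Antipodal⇒∣-∣≡n p)) (∣n-n∣≡0 i)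

  Antipodal-functional : ∀ {i j k} → j < 2 * n → k < 2 * n →
                         Antipodal n i j → Antipodal n i k → j ≡ k
  Antipodal-functional _ _ (inj₁ p) (inj₁ q) = ≡-trans p (sym q)
  Antipodal-functional _ _ (inj₂ p) (inj₂ q) = +-cancelʳ-≡ n _ _ (≡-trans (sym p) q)
  Antipodal-functional {k = k} j<2n _    (inj₁ refl) (inj₂ refl) = ⊥-elim (k+n+n≮2n {k} {n} j<2n)
  Antipodal-functional {j = j} _    k<2n (inj₂ refl) (inj₁ refl) = ⊥-elim (k+n+n≮2n {j} {n} k<2n)

-- When exactly one of i, j is shifted up by n, the two differences add up to 2n.
cyclicLength-antipodal : ∀ {n i j i′ j′} → i < 2 * n → j < 2 * n → i′ < 2 * n → j′ < 2 * n →
  Antipodal n i i′ → Antipodal n j j′ → cyclicLength (2 * n) ∣ i′ - j′ ∣ ≡ cyclicLength (2 * n) ∣ i - j ∣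
cyclicLength-antipodal {n} {i} {j} _ _ _ _ (inj₁ refl) (inj₁ refl) =
  cong (cyclicLength (2 * n)) (∣m+n-o+n∣≡∣m-o∣ n i j)
cyclicLength-antipodal {n} {i′ = i′} {j′} _ _ _ _ (inj₂ refl) (inj₂ refl) =
  cong (cyclicLength (2 * n)) (sym (∣m+n-o+n∣≡∣m-o∣ n i′ j′))
cyclicLength-antipodal {n} {i} {j′ = j′} _ j<2n i′<2n _ (inj₁ refl) (inj₂ refl) =
  cyclicLength-complement (∣m+n-o∣+∣m-o+n∣≡2n (m+n<2n⇒m≤n {i} i′<2n) (m+n<2n⇒m≤n {j′} j<2n))
cyclicLength-antipodal {n} {j = j} {i′} i<2n _ _ j′<2n (inj₂ refl) (inj₁ refl) =
  sym (cyclicLength-complement (∣m+n-o∣+∣m-o+n∣≡2n (m+n<2n⇒m≤n {i′} i<2n) (m+n<2n⇒m≤n {j} j′<2n)))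

module _ (n : ℕ) where

  Opposite : Fin (2 * n) → Fin (2 * n) → Set
  Opposite a b = Antipodal n (toℕ a) (toℕ b)

  dist : Fin (2 * n) → Fin (2 * n) → ℕ
  dist a b = cyclicLength (2 * n) ∣ toℕ a - toℕ b ∣

  dist-comm : ∀ a b → dist a b ≡ dist b a
  dist-comm a b = cong (cyclicLength (2 * n)) (∣-∣-comm (toℕ a) (toℕ b))

  dist≡n⇒Opposite : ∀ {a b} → dist a b ≡ n → Opposite a b
  dist≡n⇒Opposite {a} {b} eq = ∣-∣≡n⇒Antipodal (cyclicLength[2n]≡n⇒≡n ∣a-b∣≤2n eq)
    where
    ∣a-b∣≤2n : ∣ toℕ a - toℕ b ∣ ≤ 2 * n
    ∣a-b∣≤2n = ≤-trans (∣m-n∣≤m⊔n (toℕ a) (toℕ b)) (⊔-lub (<⇒≤ (toℕ<n a)) (<⇒≤ (toℕ<n b)))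

  Opposite⇒dist≡n : ∀ {a b} → Opposite a b → dist a b ≡ n
  Opposite⇒dist≡n a⇄b rewrite Antipodal⇒∣-∣≡n a⇄b = cyclicLength[2n]-n n

  ∃-Opposite : (a : Fin (2 * n)) → ∃[ b ] Opposite a b
  ∃-Opposite a with toℕ a <? n
  ... | yes a<n = fromℕ< a+n<2n , inj₁ (toℕ-fromℕ< a+n<2n)
    where
    a+n<2n : toℕ a + n < 2 * n
    a+n<2n = subst (toℕ a + n <_) (sym (2*n≡n+n n)) (+-monoˡ-< n a<n)
  ... | no a≮n = fromℕ< a∸n<2n , inj₂ (sym (≡-trans (cong (_+ n) (toℕ-fromℕ< a∸n<2n)) (m∸n+n≡m (≮⇒≥ a≮n))))
    where
    a∸n<2n : toℕ a ∸ n < 2 * n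
    a∸n<2n = ≤-<-trans (m∸n≤m (toℕ a) n) (toℕ<n a)

  antipode : Fin (2 * n) → Fin (2 * n)
  antipode = proj₁ ∘ ∃-Opposite

  Opposite-antipode : ∀ a → Opposite a (antipode a)
  Opposite-antipode = proj₂ ∘ ∃-Opposite

  Opposite⇒≡antipode : ∀ {a b} → Opposite a b → b ≡ antipode a
  Opposite⇒≡antipode {a} {b} a⇄b =
    toℕ-injective (Antipodal-functional (toℕ<n b) (toℕ<n (antipode a)) a⇄b (Opposite-antipode a))

  antipode-involutive : ∀ a → antipode (antipode a) ≡ a
  antipode-involutive a = sym (Opposite⇒≡antipode (Antipodal-sym (Opposite-antipode a)))

  antipode-injective : ∀ {a b} → antipode a ≡ antipode b → a ≡ b
  antipode-injective {a} {b} eq = begin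
    a                       ≡⟨ sym (antipode-involutive a) ⟩
    antipode (antipode a)   ≡⟨ cong antipode eq ⟩
    antipode (antipode b)   ≡⟨ antipode-involutive b ⟩
    b                       ∎
    where open ≡-Reasoning

  antipode-≢ : ∀ a → antipode a ≢ a
  antipode-≢ a eq with Antipodal-refl⇒n≡0 (subst (Opposite a) eq (Opposite-antipode a))
  ... | refl = ⊥-elim (n≮0 (toℕ<n a))

  dist-antipode : ∀ a b → dist (antipode a) (antipode b) ≡ dist a b
  dist-antipode a b = cyclicLength-antipodal (toℕ<n a) (toℕ<n b) (toℕ<n (antipode a)) (toℕ<n (antipode b))
                                             (Opposite-antipode a) (Opposite-antipode b)

  dist-on-same-pair : ∀ {c d x y} → x ≡ c ⊎ x ≡ d → y ≡ c ⊎ y ≡ d → x ≢ y → dist c d ≡ dist x y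
  dist-on-same-pair (inj₁ refl) (inj₂ refl) _   = refl
  dist-on-same-pair {x = x} {y} (inj₂ refl) (inj₁ refl) _ = dist-comm y x
  dist-on-same-pair (inj₁ refl) (inj₁ refl) x≢y = ⊥-elim (x≢y refl)
  dist-on-same-pair (inj₂ refl) (inj₂ refl) x≢y = ⊥-elim (x≢y refl)

  IsDiameter : Edge (2 * n) → Set
  IsDiameter e = edgeLength e ≡ n

  antipode-∈-endpoints : ∀ {D a} → All IsDiameter D → a ∈ endpoints D → antipode a ∈ endpoints D
  antipode-∈-endpoints {((_ , _) , _) ∷ _} (uw ∷ _) (here refl) =
    there (here (sym (Opposite⇒≡antipode (dist≡n⇒Opposite uw))))
  antipode-∈-endpoints {((_ , _) , _) ∷ _} (uw ∷ _) (there (here refl)) =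
    here (sym (Opposite⇒≡antipode (Antipodal-sym (dist≡n⇒Opposite uw))))
  antipode-∈-endpoints (_ ∷ diam) (there (there a∈)) = there (there (antipode-∈-endpoints diam a∈))

  non-diameters-same-length : ∀ e₁ e₂ D → IsPerfectMatching (e₁ ∷ e₂ ∷ D) →
    All IsDiameter D → ¬ IsDiameter e₁ → edgeLength e₂ ≡ edgeLength e₁
  non-diameters-same-length ((a , b) , a≢b) ((c , d) , _) D perfect diam ab-not-diameter =
    ≡-trans (dist-on-same-pair ā-location b̄-location (a≢b ∘ antipode-injective)) (dist-antipode a b)
    where
    R : List (Fin (2 * n))
    R = endpoints D

    covered : ∀ z → z ∈ a ∷ b ∷ c ∷ d ∷ R
    covered z = ∈-resp-↭ (↭-sym perfect) (∈-allFin z)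

    distinct : Unique (a ∷ b ∷ c ∷ d ∷ R)
    distinct = Unique-resp-↭ (↭-sym perfect) (allFin⁺ (2 * n))

    a∉R : a ∉ R
    a∉R = Unique[x∷xs]⇒x∉xs distinct ∘ there ∘ there ∘ there

    b∉R : b ∉ R
    b∉R = Unique[x∷xs]⇒x∉xs (AllPairs.tail distinct) ∘ there ∘ there

    antipode-∉ : ∀ {z} → z ∉ R → antipode z ∉ R
    antipode-∉ {z} z∉R z̄∈R = z∉R (subst (_∈ R) (antipode-involutive z) (antipode-∈-endpoints diam z̄∈R))

    b≢ā : b ≢ antipode a
    b≢ā b≡ā = ab-not-diameter (Opposite⇒dist≡n (subst (Opposite a) (sym b≡ā) (Opposite-antipode a)))

    ā-location : antipode a ≡ c ⊎ antipode a ≡ d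
    ā-location = ∈-resolve (covered _) (antipode-∉ a∉R) (antipode-≢ a) (b≢ā ∘ sym)

    b̄-location : antipode b ≡ c ⊎ antipode b ≡ d
    b̄-location = ∈-resolve (covered _) (antipode-∉ b∉R)
                   (λ b̄≡a → b≢ā (≡-trans (sym (antipode-involutive b)) (cong antipode b̄≡a)))
                   (antipode-≢ b)

proposition2p10 : (x y n : ℕ) → 1 ≤ x → x < y → y < n →
    (F : List (Edge (2 * n))) → ¬ (IsPerfectMatching F × (lengths F ↭ (x ∷ y ∷ replicate (n ∸ 2) n)))
proposition2p10 x y n _ x<y y<n F (perfect , F-lengths) with ↭-map-inv edgeLength F-lengths
... | e₁ ∷ e₂ ∷ D , lengths≡ , F↭e₁e₂D = <-irrefl (≡-trans x≡ℓ₁ (≡-trans (sym ℓ₂≡ℓ₁) (sym y≡ℓ₂))) x<y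
  where
  x≡ℓ₁ : x ≡ edgeLength e₁
  x≡ℓ₁ = proj₁ (∷-injective lengths≡)
  y≡ℓ₂ : y ≡ edgeLength e₂
  y≡ℓ₂ = proj₁ (∷-injective (proj₂ (∷-injective lengths≡)))
  diameters : All (IsDiameter n) D
  diameters = map⁻ (subst (All (_≡ n)) (proj₂ (∷-injective (proj₂ (∷-injective lengths≡))))
                          (replicate⁺ (n ∸ 2) refl))
  ℓ₂≡ℓ₁ : edgeLength e₂ ≡ edgeLength e₁
  ℓ₂≡ℓ₁ = non-diameters-same-length n e₁ e₂ D
            (↭-trans (concatMap⁺ _ (↭-sym F↭e₁e₂D)) perfect)
            diameters (λ ℓ₁≡n → <-irrefl (≡-trans x≡ℓ₁ ℓ₁≡n) (<-trans x<y y<n))
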